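{- For $n\ge 1$, let $g_{n,4}$ denote the number of standard Young tableaux of truncated shifted shape with $n$ rows and $4$ boxes in each row. Then $g_{n,4}=P_{2n-1}$, the $(2n-1)$-st Pell number, and consequently $$g_{n,4}=6g_{n-1,4}-g_{n-2,4}\quad (n\ge 3),\qquad g_{1,4}=1,\ g_{2,4}=5.$$
   Context: The truncated shifted shape with $n$ rows and $k$ boxes in each row is the set of boxes $(i,c)$ with $1\le i\le n$ and $i\le c\le i+k-1$ (row $i$ consists of $k$ consecutive boxes starting in column $i$). A standard Young tableau of this shape is a bijective labeling of its $nk$ boxes by $\{1,\dots,nk\}$ such that labels increase from left to right along each row and from top to bottom along each column. The Pell numbers are defined by $P_0=0$, $P_1=1$, $P_n=2P_{n-1}+P_{n-2}$. -}

module Defs where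

open import Data.Nat using (ℕ; zero; suc; _+_; _*_; _<_; _≤_)
open import Data.Fin using (Fin; toℕ)
open import Data.Vec using (Vec; lookup)
open import Data.Product using (Σ; ∃; _×_)
open import Relation.Binary.PropositionalEquality using (_≡_; _≢_)
open import Function.Definitions using (Injective)

Pell : ℕ → ℕ
Pell zero = 0
Pell (suc zero) = 1
Pell (suc (suc n)) = 2 * Pell (suc n) + Pell n

-- A labeling of the truncated shifted shape with n rows and k boxes per row.
-- Row i (0-based i : Fin n, i.e. row i+1 of the paper) consists of the k boxes
-- in (1-based) columns (i+1), ..., (i+1)+(k-1).  The entry  lookup (lookup T i) j
-- (j : Fin k) is the label of the box in row i+1, column (i+1)+j.
Labeling : ℕ → ℕ → Set
Labeling n k = Vec (Vec ℕ k) n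

label : ∀ {n k} → Labeling n k → Fin n → Fin k → ℕ
label T i j = lookup (lookup T i) j

record IsSYT (n k : ℕ) (T : Labeling n k) : Set where
  field
    inRange    : ∀ i j → 1 ≤ label T i j × label T i j ≤ n * k
    injective  : ∀ i j i′ j′ → label T i j ≡ label T i′ j′ → (i ≡ i′ × j ≡ j′)
    surjective : ∀ m → 1 ≤ m → m ≤ n * k → Σ (Fin n) λ i → Σ (Fin k) λ j → label T i j ≡ m
    rowIncr    : ∀ i (j j′ : Fin k) → toℕ j < toℕ j′ → label T i j < label T i j′
    -- columns increase top to bottom: boxes (i,c) and (i′,c) in the same
    -- column c = i + j = i′ + j′ (0-based shift), with row i above row i′
    colIncr    : ∀ (i i′ : Fin n) (j j′ : Fin k) → toℕ i < toℕ i′ →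
                 toℕ i + toℕ j ≡ toℕ i′ + toℕ j′ → label T i j < label T i′ j′

HasCard : {A : Set} → (A → Set) → ℕ → Set
HasCard {A} P m =
  Σ (Fin m → A) λ f →
    Injective _≡_ _≡_ f × (∀ x → P (f x)) × (∀ a → P a → ∃ λ x → f x ≡ a)

-- g n k = m  is expressed as  NumSYT n k m
NumSYT : ℕ → ℕ → ℕ → Set
NumSYT n k m = HasCard (IsSYT n k) m

module Submission where

-- Standard Young tableaux of the truncated shifted shape with n rows of 4
-- boxes are counted by a corner recurrence.  We generalise to partial shapes:
-- a profile L says that row x keeps its first L x boxes, and a generalized
-- tableau of profile L with s entries labels exactly those boxes by 1,…,s,
-- increasingly along rows and down columns.  For admissible profiles the
-- largest entry sits in a removable corner, and deleting it is a bijection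
-- onto the tableaux of the profile with that corner removed; so the number of
-- tableaux is the sum of the numbers for the profiles with one corner removed.
--
-- The full shape (tail ∅, f = n) gives
-- g_{n,4} = P_{2n-1}; the recurrence follows from P_{k+4} + P_k = 6 P_{k+2}
-- and the uniqueness of cardinalities.

open import Defs
open import Data.Nat using (ℕ; zero; suc; pred; _+_; _*_; _∸_; _≤_; _<_; _>_; z≤n; s≤s)
open import Data.Nat.Properties
open import Data.Nat.Tactic.RingSolver using (solve-∀)
open import Data.Fin using (Fin; toℕ; fromℕ<; splitAt; join; _↑ˡ_; _↑ʳ_)
open import Data.Fin.Properties
  using (injective⇒≤; splitAt-↑ˡ; splitAt-↑ʳ; join-splitAt; toℕ-injective; toℕ<n; toℕ-fromℕ<)
  renaming (_≟_ to _≟ᶠ_)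
open import Data.Vec using (lookup; replicate; _[_]%=_; _[_]≔_)
open import Data.Vec.Properties
  using (tabulate∘lookup; tabulate-cong; lookup-replicate; lookup∘updateAt; lookup∘updateAt′)
open import Data.List using (List; []; _∷_; length; filter; upTo)
open import Data.Nat.ListAction using (sum)
open import Data.List.Relation.Unary.All using (All; []; _∷_; all?)
open import Data.List.Relation.Unary.Linked using (Linked; []; [-]; _∷_; linked?)
open import Data.List.Membership.Propositional using (_∈_)
open import Data.List.Membership.Propositional.Properties using (∈-filter⁺; ∈-filter⁻; ∈-upTo⁺)
open import Data.List.Relation.Unary.Any using (here; there)
open import Data.Product using (Σ; ∃; _×_; _,_; proj₁; proj₂)
open import Data.Sum using (_⊎_; inj₁; inj₂)
open import Data.Empty using (⊥; ⊥-elim)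
open import Function using (_∘_)
open import Relation.Nullary using (¬_; Dec; yes; no)
open import Relation.Nullary.Decidable using (True; toWitness; _×-dec_; _⊎-dec_)
open import Relation.Binary.PropositionalEquality hiding (J)

card-unique : ∀ {A : Set} {P : A → Set} {m m′} → HasCard P m → HasCard P m′ → m ≡ m′
card-unique {P = P} {m} {m′} (f , f-inj , fP , f-onto) (g , g-inj , gP , g-onto) =
  ≤-antisym (injective⇒≤ {f = to} to-inj) (injective⇒≤ {f = from} from-inj)
  where
  to : Fin m → Fin m′
  to x = proj₁ (g-onto (f x) (fP x))
  from : Fin m′ → Fin m
  from y = proj₁ (f-onto (g y) (gP y))
  to-inj : ∀ {x y} → to x ≡ to y → x ≡ y
  to-inj {x} {y} e = f-inj (trans (sym (proj₂ (g-onto (f x) (fP x))))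
                                  (trans (cong g e) (proj₂ (g-onto (f y) (fP y)))))
  from-inj : ∀ {x y} → from x ≡ from y → x ≡ y
  from-inj {x} {y} e = g-inj (trans (sym (proj₂ (f-onto (g x) (gP x))))
                                    (trans (cong f e) (proj₂ (f-onto (g y) (gP y)))))

card-cong : ∀ {A : Set} {P Q : A → Set} {m} →
  (∀ a → P a → Q a) → (∀ a → Q a → P a) → HasCard P m → HasCard Q m
card-cong p⇒q q⇒p (f , f-inj , fP , f-onto) =
  f , f-inj , (λ x → p⇒q _ (fP x)) , λ a q → f-onto a (q⇒p a q)

card-single : ∀ {A : Set} {P : A → Set} (x : A) → P x → (∀ a → P a → a ≡ x) → HasCard P 1
card-single x px unique =
  (λ _ → x) , (λ { {Fin.zero} {Fin.zero} _ → refl }) , (λ _ → px) , λ a pa → Fin.zero , sym (unique a pa)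

card-image : ∀ {A B : Set} {P : A → Set} {Q : B → Set} {m} (g : B → A) →
  (∀ a b → Q a → Q b → g a ≡ g b → a ≡ b) → (∀ b → Q b → P (g b)) →
  (∀ a → P a → Σ B λ b → Q b × g b ≡ a) → HasCard Q m → HasCard P m
card-image g g-inj gP g-onto (f , f-inj , fQ , f-onto) =
  (λ x → g (f x)) , (λ {x} {y} e → f-inj (g-inj _ _ (fQ x) (fQ y) e)) , (λ x → gP _ (fQ x)) ,
  λ a pa → let (b , qb , gb≡a) = g-onto a pa ; (x , fx≡b) = f-onto b qb
           in x , trans (cong g fx≡b) gb≡a

card-union : ∀ {A : Set} {P P₁ P₂ : A → Set} {m₁ m₂} →
  (∀ a → P₁ a → P₂ a → ⊥) → (∀ a → P a → P₁ a ⊎ P₂ a) → (∀ a → P₁ a → P a) → (∀ a → P₂ a → P a) →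
  HasCard P₁ m₁ → HasCard P₂ m₂ → HasCard P (m₁ + m₂)
card-union {A} {P} {P₁} {P₂} {m₁} {m₂} disjoint cover sub₁ sub₂
           (f₁ , f₁-inj , f₁P , f₁-onto) (f₂ , f₂-inj , f₂P , f₂-onto) =
  (λ x → f (splitAt m₁ x)) , inj , (λ x → fP (splitAt m₁ x)) , onto
  where
  f : Fin m₁ ⊎ Fin m₂ → A
  f (inj₁ x) = f₁ x
  f (inj₂ x) = f₂ x
  fP : ∀ x → P (f x)
  fP (inj₁ x) = sub₁ _ (f₁P x)
  fP (inj₂ x) = sub₂ _ (f₂P x)
  f-inj : ∀ x y → f x ≡ f y → x ≡ y
  f-inj (inj₁ x) (inj₁ y) e = cong inj₁ (f₁-inj e)
  f-inj (inj₁ x) (inj₂ y) e = ⊥-elim (disjoint _ (f₁P x) (subst P₂ (sym e) (f₂P y)))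
  f-inj (inj₂ x) (inj₁ y) e = ⊥-elim (disjoint _ (f₁P y) (subst P₂ e (f₂P x)))
  f-inj (inj₂ x) (inj₂ y) e = cong inj₂ (f₂-inj e)
  inj : ∀ {x y} → f (splitAt m₁ x) ≡ f (splitAt m₁ y) → x ≡ y
  inj {x} {y} e = trans (sym (join-splitAt m₁ m₂ x))
                   (trans (cong (join m₁ m₂) (f-inj (splitAt m₁ x) (splitAt m₁ y) e)) (join-splitAt m₁ m₂ y))
  onto : ∀ a → P a → ∃ λ x → f (splitAt m₁ x) ≡ a
  onto a pa with cover a pa
  ... | inj₁ p₁ = let (x , e) = f₁-onto a p₁ in x ↑ˡ m₂ , trans (cong f (splitAt-↑ˡ m₁ x m₂)) e
  ... | inj₂ p₂ = let (x , e) = f₂-onto a p₂ in m₁ ↑ʳ x , trans (cong f (splitAt-↑ʳ m₁ m₂ x)) e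

labeling-ext : ∀ {n k} {T T′ : Labeling n k} → (∀ i j → label T i j ≡ label T′ i j) → T ≡ T′
labeling-ext {T = T} {T′} same =
  trans (sym (tabulate∘lookup T))
    (trans (tabulate-cong λ i → trans (sym (tabulate∘lookup (lookup T i)))
                                   (trans (tabulate-cong (same i)) (tabulate∘lookup (lookup T′ i))))
           (tabulate∘lookup T′))

relabel : ∀ {n k} → Labeling n k → Fin n → Fin k → ℕ → Labeling n k
relabel T r c v = T [ r ]%= (_[ c ]≔ v)

relabel-same : ∀ {n k} (T : Labeling n k) r c v → label (relabel T r c v) r c ≡ v
relabel-same T r c v =
  trans (cong (λ row → lookup row c) (lookup∘updateAt r T)) (lookup∘updateAt c (lookup T r))

relabel-other : ∀ {n k} (T : Labeling n k) r c v i j → ¬ (i ≡ r × j ≡ c) →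
  label (relabel T r c v) i j ≡ label T i j
relabel-other T r c v i j other with i ≟ᶠ r
... | yes refl = trans (cong (λ row → lookup row j) (lookup∘updateAt r T))
                       (lookup∘updateAt′ j c (λ j≡c → other (refl , j≡c)) (lookup T r))
... | no i≢r   = cong (λ row → lookup row j) (lookup∘updateAt′ i r i≢r T)

-- A profile L prescribes how many boxes of each row are present: row x keeps
-- its first L x boxes.
Profile : Set
Profile = ℕ → ℕ

record IsGT (n k : ℕ) (L : Profile) (s : ℕ) (T : Labeling n k) : Set where
  field
    inRange    : ∀ i j → toℕ j < L (toℕ i) → 1 ≤ label T i j × label T i j ≤ s
    absent     : ∀ i j → L (toℕ i) ≤ toℕ j → label T i j ≡ 0
    injective  : ∀ i j i′ j′ → toℕ j < L (toℕ i) → toℕ j′ < L (toℕ i′) →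
                 label T i j ≡ label T i′ j′ → i ≡ i′ × j ≡ j′
    surjective : ∀ m → 1 ≤ m → m ≤ s →
                 Σ (Fin n) λ i → Σ (Fin k) λ j → toℕ j < L (toℕ i) × label T i j ≡ m
    rowIncr    : ∀ i (j j′ : Fin k) → toℕ j < toℕ j′ → toℕ j′ < L (toℕ i) →
                 label T i j < label T i j′
    colIncr    : ∀ (i i′ : Fin n) (j j′ : Fin k) → toℕ i < toℕ i′ → toℕ i + toℕ j ≡ toℕ i′ + toℕ j′ →
                 toℕ j′ < L (toℕ i′) → label T i j < label T i′ j′

label-bound : ∀ {n k L s T} → IsGT n k L s T → ∀ i j → label T i j ≤ s
label-bound {L = L} G i j with toℕ j <? L (toℕ i)
... | yes present = proj₂ (IsGT.inRange G i j present)
... | no absent   = subst (_≤ _) (sym (IsGT.absent G i j (≮⇒≥ absent))) z≤n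

IsGT-cong : ∀ {n k L L′ s T} → (∀ x → L x ≡ L′ x) → IsGT n k L s T → IsGT n k L′ s T
IsGT-cong {L = L} {L′} e G = record
  { inRange    = λ i j h → inRange i j (back h)
  ; absent     = λ i j h → absent i j (subst (_≤ toℕ j) (sym (e (toℕ i))) h)
  ; injective  = λ i j i′ j′ h h′ → injective i j i′ j′ (back h) (back h′)
  ; surjective = λ m p q → let (i , j , h , l) = surjective m p q
                           in i , j , subst (toℕ j <_) (e (toℕ i)) h , l
  ; rowIncr    = λ i j j′ lt h → rowIncr i j j′ lt (back h)
  ; colIncr    = λ i i′ j j′ lt c h → colIncr i i′ j j′ lt c (back h) }
  where
  open IsGT G
  back : ∀ {a x} → a < L′ x → a < L x
  back {a} {x} = subst (a <_) (sym (e x))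

card-IsGT-cong : ∀ {n k L L′ s m} → (∀ x → L x ≡ L′ x) →
  HasCard (IsGT n k L s) m → HasCard (IsGT n k L′ s) m
card-IsGT-cong e = card-cong (λ _ → IsGT-cong e) (λ _ → IsGT-cong (λ x → sym (e x)))

SYT⇒GT : ∀ {n k L T} → (∀ (i : Fin n) → L (toℕ i) ≡ k) → IsSYT n k T → IsGT n k L (n * k) T
SYT⇒GT {n} {k} {L} full S = record
  { inRange    = λ i j _ → inRange i j
  ; absent     = λ i j h → ⊥-elim (<⇒≱ (toℕ<n j) (subst (_≤ toℕ j) (full i) h))
  ; injective  = λ i j i′ j′ _ _ → injective i j i′ j′
  ; surjective = λ m p q → let (i , j , l) = surjective m p q in i , j , present i j , l
  ; rowIncr    = λ i j j′ lt _ → rowIncr i j j′ lt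
  ; colIncr    = λ i i′ j j′ lt c _ → colIncr i i′ j j′ lt c }
  where
  open IsSYT S
  present : ∀ (i : Fin n) (j : Fin k) → toℕ j < L (toℕ i)
  present i j = subst (toℕ j <_) (sym (full i)) (toℕ<n j)

GT⇒SYT : ∀ {n k L T} → (∀ (i : Fin n) → L (toℕ i) ≡ k) → IsGT n k L (n * k) T → IsSYT n k T
GT⇒SYT {n} {k} {L} full G = record
  { inRange    = λ i j → inRange i j (present i j)
  ; injective  = λ i j i′ j′ → injective i j i′ j′ (present i j) (present i′ j′)
  ; surjective = λ m p q → let (i , j , _ , l) = surjective m p q in i , j , l
  ; rowIncr    = λ i j j′ lt → rowIncr i j j′ lt (present i j′)
  ; colIncr    = λ i i′ j j′ lt c → colIncr i i′ j j′ lt c (present i′ j′) }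
  where
  open IsGT G
  present : ∀ (i : Fin n) (j : Fin k) → toℕ j < L (toℕ i)
  present i j = subst (toℕ j <_) (sym (full i)) (toℕ<n j)

card-empty : ∀ {n k L} → (∀ x → L x ≡ 0) → HasCard (IsGT n k L 0) 1
card-empty {n} {k} {L} empty = card-single zeros zeros-GT unique
  where
  zeros : Labeling n k
  zeros = replicate n (replicate k 0)
  zeros-label : ∀ i j → label zeros i j ≡ 0
  zeros-label i j rewrite lookup-replicate i (replicate k 0) = lookup-replicate j 0
  nothing-present : ∀ {a x} → a < L x → ⊥
  nothing-present {a} {x} h with subst (a <_) (empty x) h
  ... | ()
  zeros-GT : IsGT n k L 0 zeros
  zeros-GT = record
    { inRange    = λ i j h → ⊥-elim (nothing-present h)
    ; absent     = λ i j _ → zeros-label i j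
    ; injective  = λ i j i′ j′ h → ⊥-elim (nothing-present h)
    ; surjective = λ m p q → ⊥-elim (<-irrefl refl (≤-trans p q))
    ; rowIncr    = λ i j j′ lt h → ⊥-elim (nothing-present h)
    ; colIncr    = λ i i′ j j′ lt c h → ⊥-elim (nothing-present h) }
  unique : ∀ T → IsGT n k L 0 T → T ≡ zeros
  unique T G = labeling-ext λ i j →
    trans (IsGT.absent G i j (subst (_≤ toℕ j) (sym (empty (toℕ i))) z≤n)) (sym (zeros-label i j))

-- Profiles that can occur while a tableau of the truncated shifted shape is
-- filled in increasing order: at most k boxes per row, no boxes in rows ≥ n,
-- and every nonempty row is strictly shorter than a non-full row above it.
record Admissible (n k : ℕ) (L : Profile) : Set where
  field
    bounded   : ∀ x → L x ≤ k
    vanishes  : ∀ x → n ≤ x → L x ≡ 0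
    shortens  : ∀ x → L (suc x) ≡ 0 ⊎ L x ≡ k ⊎ L (suc x) < L x

present-box : ∀ {n k L} → Admissible n k L → ∀ x y → y < L x →
  Σ (Fin n) λ i → Σ (Fin k) λ j → toℕ i ≡ x × toℕ j ≡ y
present-box {n} {k} {L} A x y y<Lx with x <? n
... | no x≮n = ⊥-elim (<⇒≱ y<Lx (subst (_≤ y) (sym (Admissible.vanishes A x (≮⇒≥ x≮n))) z≤n))
... | yes x<n = fromℕ< x<n , fromℕ< y<k , toℕ-fromℕ< x<n , toℕ-fromℕ< y<k
  where y<k = ≤-trans y<Lx (Admissible.bounded A x)

column-closed : ∀ {n k L} → Admissible n k L → ∀ x y → y < L (suc x) → suc y < k → suc y < L x
column-closed {L = L} A x y y<L y+1<k with Admissible.shortens A x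
... | inj₁ empty        = ⊥-elim (<⇒≱ y<L (subst (_≤ y) (sym empty) z≤n))
... | inj₂ (inj₁ full)  = subst (suc y <_) (sym full) y+1<k
... | inj₂ (inj₂ short) = ≤-trans (s≤s y<L) short

-- The last box of row R can be removed (leaving a shape of the same kind)
-- iff it is the only box or the row below is at least two boxes shorter.
Removable : Profile → ℕ → Set
Removable L R = L R ≡ 1 ⊎ L (suc R) + 2 ≤ L R

record Corner (L : Profile) : Set where
  constructor corner
  field
    row       : ℕ
    col       : ℕ
    lastBox   : L row ≡ suc col
    removable : Removable L row
open Corner

corner-col : ∀ {L} (c c′ : Corner L) → row c ≡ row c′ → col c ≡ col c′
corner-col {L} c c′ same = suc-injective (trans (sym (lastBox c)) (trans (cong L same) (lastBox c′)))

corner-column-free : ∀ {n k L} → Admissible n k L → (c : Corner L) →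
  ∀ x y → row c < x → row c + col c ≡ x + y → y < L x → ⊥
corner-column-free {k = k} {L} A (corner R J lastBox removable) x y R<x same-col y<Lx
  with m≤n⇒∃[o]m+o≡n R<x
... | d , refl = below d y (+-cancelˡ-≡ R J (suc (d + y)) (trans same-col (shift R d y))) y<Lx
  where
  shift : ∀ R d y → suc R + d + y ≡ R + suc (d + y)
  shift = solve-∀
  J<k : J < k
  J<k = subst (_≤ k) lastBox (Admissible.bounded A R)
  -- box (R+1+d , y) with J = 1 + d + y would lie in the corner's column
  below : ∀ d y → J ≡ suc (d + y) → y < L (suc R + d) → ⊥
  below zero y refl y<L = blocked removable
    where
    blocked : Removable L R → ⊥
    blocked (inj₁ R-single) = 0≢1+n (sym (suc-injective (trans (sym lastBox) R-single)))
    blocked (inj₂ R-long) =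
      <⇒≱ (subst (λ z → y < L z) (+-identityʳ (suc R)) y<L)
          (≤-pred (≤-pred (subst (_≤ suc (suc y)) (+-comm (L (suc R)) 2)
                             (subst (L (suc R) + 2 ≤_) lastBox R-long))))
  below (suc d) y J≡ y<L = below d (suc y) (trans J≡ (cong suc (sym (+-suc d y)))) above
    where
    above : suc y < L (suc R + d)
    above = column-closed A (suc R + d) y (subst (λ z → y < L z) (+-suc (suc R) d) y<L)
              (≤-trans (s≤s (s≤s (m≤n+m y d))) (<⇒≤ (subst (_< k) J≡ J<k)))

MaxAt : ∀ {n k L} → ℕ → Corner L → Labeling n k → Set
MaxAt {n} {k} {L} s c a =
  IsGT n k L (suc s) a ×
  Σ (Fin n) λ i → Σ (Fin k) λ j → toℕ i ≡ row c × toℕ j ≡ col c × label a i j ≡ suc s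

-- The largest entry of a generalized tableau of an admissible profile sits in
-- a corner: no box to its right (rows increase) and no box below it in its
-- column (columns increase).
max-at-corner : ∀ {n k L s a} → Admissible n k L → IsGT n k L (suc s) a → Σ (Corner L) λ c → MaxAt s c a
max-at-corner {n} {k} {L} {s} {a} A G with IsGT.surjective G (suc s) (s≤s z≤n) ≤-refl
... | r , j , j-present , is-max =
  corner (toℕ r) (toℕ j) last (is-removable (toℕ j) refl) , G , r , j , refl , refl , is-max
  where
  open IsGT G
  R = toℕ r
  exceeds-max : ∀ i′ j′ → label a r j < label a i′ j′ → ⊥
  exceeds-max i′ j′ bigger = <⇒≱ (subst (_< label a i′ j′) is-max bigger) (label-bound G i′ j′)
  last : L R ≡ suc (toℕ j)
  last with L R ≤? suc (toℕ j)
  ... | yes L≤ = ≤-antisym L≤ j-present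
  ... | no L≰ with present-box A R (suc (toℕ j)) (≰⇒> L≰)
  ...   | i′ , j′ , i′≡ , j′≡ with toℕ-injective {i = i′} {j = r} i′≡
  ...     | refl = ⊥-elim (exceeds-max r j′ (rowIncr r j j′ (subst (toℕ j <_) (sym j′≡) ≤-refl)
                                                 (subst (_< L R) (sym j′≡) (≰⇒> L≰))))
  is-removable : ∀ J → toℕ j ≡ J → Removable L R
  is-removable zero     j≡0 = inj₁ (trans last (cong suc j≡0))
  is-removable (suc j₀) j≡  = inj₂ (subst (_≤ L R) (+-comm 2 (L (suc R)))
                                  (subst (suc (suc (L (suc R))) ≤_) (sym (trans last (cong suc j≡)))
                                         (s≤s (s≤s below-short))))
    where
    below-short : L (suc R) ≤ j₀
    below-short with L (suc R) ≤? j₀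
    ... | yes short = short
    ... | no long with present-box A (suc R) j₀ (≰⇒> long)
    ...   | i′ , j′ , i′≡ , j′≡ = ⊥-elim (exceeds-max i′ j′ (colIncr r i′ j j′
                                      (subst (R <_) (sym i′≡) ≤-refl)
                                      (trans (cong (R +_) j≡) (trans (+-suc R j₀) (sym (cong₂ _+_ i′≡ j′≡))))
                                      (subst₂ (λ x y → y < L x) (sym i′≡) (sym j′≡) (≰⇒> long))))

shorten : Profile → ℕ → ℕ → Profile
shorten L R J x with x ≟ R
... | yes _ = J
... | no _  = L x

shorten-same : ∀ L R J → shorten L R J R ≡ J
shorten-same L R J with R ≟ R
... | yes _  = refl
... | no R≢R = ⊥-elim (R≢R refl)

shorten-other : ∀ L R J x → x ≢ R → shorten L R J x ≡ L x
shorten-other L R J x x≢R with x ≟ R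
... | yes x≡R = ⊥-elim (x≢R x≡R)
... | no _    = refl

shorten-unique : ∀ L R J {L′ : Profile} → L′ R ≡ J → (∀ x → x ≢ R → L′ x ≡ L x) →
  ∀ x → L′ x ≡ shorten L R J x
shorten-unique L R J at-R elsewhere x with x ≟ R
... | yes refl = at-R
... | no x≢R   = elsewhere x x≢R

removeCorner : ∀ {L} → Corner L → Profile
removeCorner {L} c = shorten L (row c) (col c)

module Removal {n k L} (A : Admissible n k L) (c : Corner L) (s : ℕ) where

  private
    L′ = removeCorner c
    R  = row c
    J  = col c

    corner-box = present-box A R J (subst (J <_) (sym (lastBox c)) ≤-refl)
    r₀ = proj₁ corner-box
    j₀ = proj₁ (proj₂ corner-box)
    r₀≡ : toℕ r₀ ≡ R
    r₀≡ = proj₁ (proj₂ (proj₂ corner-box))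
    j₀≡ : toℕ j₀ ≡ J
    j₀≡ = proj₂ (proj₂ (proj₂ corner-box))

    New : Fin n → Fin k → Set
    New i j = i ≡ r₀ × j ≡ j₀

    new? : ∀ i j → Dec (New i j)
    new? i j = (i ≟ᶠ r₀) ×-dec (j ≟ᶠ j₀)

    L′-row : L′ (toℕ r₀) ≡ J
    L′-row = trans (cong L′ r₀≡) (shorten-same L R J)

    L-row : L (toℕ r₀) ≡ suc J
    L-row = trans (cong L r₀≡) (lastBox c)

    L′-other : ∀ (i : Fin n) → i ≢ r₀ → L′ (toℕ i) ≡ L (toℕ i)
    L′-other i i≢r₀ = shorten-other L R J (toℕ i) (λ e → i≢r₀ (toℕ-injective (trans e (sym r₀≡))))

    L′≤L : ∀ (i : Fin n) → L′ (toℕ i) ≤ L (toℕ i)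
    L′≤L i with i ≟ᶠ r₀
    ... | yes refl = subst₂ _≤_ (sym L′-row) (sym L-row) (n≤1+n J)
    ... | no i≢r₀  = ≤-reflexive (L′-other i i≢r₀)

    new-present : toℕ j₀ < L (toℕ r₀)
    new-present = subst₂ _<_ (sym j₀≡) (sym L-row) ≤-refl

    old-col : ∀ (j : Fin k) → ¬ New r₀ j → toℕ j ≢ J
    old-col j old e = old (refl , toℕ-injective (trans e (sym j₀≡)))

    present′⇒present : ∀ (i : Fin n) (j : Fin k) → toℕ j < L′ (toℕ i) → toℕ j < L (toℕ i)
    present′⇒present i j h = ≤-trans h (L′≤L i)

    present′⇒old : ∀ (i : Fin n) (j : Fin k) → toℕ j < L′ (toℕ i) → ¬ New i j
    present′⇒old i j h (refl , refl) = <-irrefl j₀≡ (subst (toℕ j₀ <_) L′-row h)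

    present⇒present′ : ∀ (i : Fin n) (j : Fin k) → toℕ j < L (toℕ i) → ¬ New i j → toℕ j < L′ (toℕ i)
    present⇒present′ i j h old with i ≟ᶠ r₀
    ... | yes refl = subst (toℕ j <_) (sym L′-row)
                       (≤∧≢⇒< (≤-pred (subst (toℕ j <_) L-row h)) (old-col j old))
    ... | no i≢r₀  = subst (toℕ j <_) (sym (L′-other i i≢r₀)) h

    absent⇒absent′ : ∀ (i : Fin n) (j : Fin k) → L (toℕ i) ≤ toℕ j → L′ (toℕ i) ≤ toℕ j
    absent⇒absent′ i j h = ≤-trans (L′≤L i) h

    absent′⇒absent : ∀ (i : Fin n) (j : Fin k) → L′ (toℕ i) ≤ toℕ j → ¬ New i j → L (toℕ i) ≤ toℕ j
    absent′⇒absent i j h old with i ≟ᶠ r₀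
    ... | yes refl = subst (_≤ toℕ j) (sym L-row)
                       (≤∧≢⇒< (subst (_≤ toℕ j) L′-row h) (λ e → old-col j old (sym e)))
    ... | no i≢r₀  = subst (_≤ toℕ j) (L′-other i i≢r₀) h

  add : Labeling n k → Labeling n k
  add b = relabel b r₀ j₀ (suc s)

  del : Labeling n k → Labeling n k
  del a = relabel a r₀ j₀ 0

  add-GT : ∀ b → IsGT n k L′ s b → IsGT n k L (suc s) (add b)
  add-GT b B = record
    { inRange = inRange′ ; absent = absent′ ; injective = injective′
    ; surjective = surjective′ ; rowIncr = rowIncr′ ; colIncr = colIncr′ }
    where
    open IsGT B
    new-label : label (add b) r₀ j₀ ≡ suc s
    new-label = relabel-same b r₀ j₀ (suc s)
    old-label : ∀ i j → ¬ New i j → label (add b) i j ≡ label b i j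
    old-label i j = relabel-other b r₀ j₀ (suc s) i j
    below-new : ∀ i j → label b i j < suc s
    below-new i j = s≤s (label-bound B i j)

    inRange′ : ∀ i j → toℕ j < L (toℕ i) → 1 ≤ label (add b) i j × label (add b) i j ≤ suc s
    inRange′ i j h with new? i j
    ... | yes (refl , refl) rewrite new-label = s≤s z≤n , ≤-refl
    ... | no old rewrite old-label i j old =
      let (pos , bound) = inRange i j (present⇒present′ i j h old) in pos , m≤n⇒m≤1+n bound
    absent′ : ∀ i j → L (toℕ i) ≤ toℕ j → label (add b) i j ≡ 0
    absent′ i j h with new? i j
    ... | yes (refl , refl) = ⊥-elim (<⇒≱ new-present h)
    ... | no old rewrite old-label i j old = absent i j (absent⇒absent′ i j h)
    injective′ : ∀ i j i′ j′ → toℕ j < L (toℕ i) → toℕ j′ < L (toℕ i′) →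
                 label (add b) i j ≡ label (add b) i′ j′ → i ≡ i′ × j ≡ j′
    injective′ i j i′ j′ h h′ e with new? i j | new? i′ j′
    ... | yes (refl , refl) | yes (refl , refl) = refl , refl
    ... | yes (refl , refl) | no old′ rewrite new-label | old-label i′ j′ old′ =
      ⊥-elim (<-irrefl (sym e) (below-new i′ j′))
    ... | no old | yes (refl , refl) rewrite new-label | old-label i j old =
      ⊥-elim (<-irrefl e (below-new i j))
    ... | no old | no old′ rewrite old-label i j old | old-label i′ j′ old′ =
      injective i j i′ j′ (present⇒present′ i j h old) (present⇒present′ i′ j′ h′ old′) e
    surjective′ : ∀ m → 1 ≤ m → m ≤ suc s →
                  Σ (Fin n) λ i → Σ (Fin k) λ j → toℕ j < L (toℕ i) × label (add b) i j ≡ m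
    surjective′ m pos bound with m ≟ suc s
    ... | yes refl = r₀ , j₀ , new-present , new-label
    ... | no m≢ = let (i , j , h , e) = surjective m pos (≤-pred (≤∧≢⇒< bound m≢))
                  in i , j , present′⇒present i j h , trans (old-label i j (present′⇒old i j h)) e
    rowIncr′ : ∀ i (j j′ : Fin k) → toℕ j < toℕ j′ → toℕ j′ < L (toℕ i) →
               label (add b) i j < label (add b) i j′
    rowIncr′ i j j′ lt h′ with new? i j′ | new? i j
    ... | yes (refl , refl) | _ rewrite new-label =
      subst (_< suc s) (sym (old-label i j λ { (_ , refl) → <-irrefl refl lt })) (below-new i j)
    ... | no old′ | yes (refl , refl) =
      ⊥-elim (<⇒≱ (subst (_< toℕ j′) j₀≡ lt) (≤-pred (subst (toℕ j′ <_) L-row h′)))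
    ... | no old′ | no old rewrite old-label i j old | old-label i j′ old′ =
      rowIncr i j j′ lt (present⇒present′ i j′ h′ old′)
    colIncr′ : ∀ (i i′ : Fin n) (j j′ : Fin k) → toℕ i < toℕ i′ → toℕ i + toℕ j ≡ toℕ i′ + toℕ j′ →
               toℕ j′ < L (toℕ i′) → label (add b) i j < label (add b) i′ j′
    colIncr′ i i′ j j′ lt same-col h′ with new? i′ j′ | new? i j
    ... | yes (refl , refl) | _ rewrite new-label =
      subst (_< suc s) (sym (old-label i j λ { (refl , _) → <-irrefl refl lt })) (below-new i j)
    ... | no old′ | yes (refl , refl) =
      ⊥-elim (corner-column-free A c (toℕ i′) (toℕ j′) (subst (_< toℕ i′) r₀≡ lt)
                (subst₂ (λ x y → x + y ≡ toℕ i′ + toℕ j′) r₀≡ j₀≡ same-col) h′)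
    ... | no old′ | no old rewrite old-label i j old | old-label i′ j′ old′ =
      colIncr i i′ j j′ lt same-col (present⇒present′ i′ j′ h′ old′)

  del-GT : ∀ a → IsGT n k L (suc s) a → label a r₀ j₀ ≡ suc s → IsGT n k L′ s (del a)
  del-GT a G is-max = record
    { inRange = inRange′ ; absent = absent′ ; injective = injective′
    ; surjective = surjective′ ; rowIncr = rowIncr′ ; colIncr = colIncr′ }
    where
    open IsGT G
    new-label : label (del a) r₀ j₀ ≡ 0
    new-label = relabel-same a r₀ j₀ 0
    old-label : ∀ i j → ¬ New i j → label (del a) i j ≡ label a i j
    old-label i j = relabel-other a r₀ j₀ 0 i j
    below-max : ∀ i j → toℕ j < L (toℕ i) → ¬ New i j → label a i j ≤ s
    below-max i j h old with label a i j ≟ suc s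
    ... | yes e = ⊥-elim (old (injective i j r₀ j₀ h new-present (trans e (sym is-max))))
    ... | no ≢max = ≤-pred (≤∧≢⇒< (proj₂ (inRange i j h)) ≢max)

    inRange′ : ∀ i j → toℕ j < L′ (toℕ i) → 1 ≤ label (del a) i j × label (del a) i j ≤ s
    inRange′ i j h rewrite old-label i j (present′⇒old i j h) =
      proj₁ (inRange i j (present′⇒present i j h)) ,
      below-max i j (present′⇒present i j h) (present′⇒old i j h)
    absent′ : ∀ i j → L′ (toℕ i) ≤ toℕ j → label (del a) i j ≡ 0
    absent′ i j h with new? i j
    ... | yes (refl , refl) = new-label
    ... | no old rewrite old-label i j old = absent i j (absent′⇒absent i j h old)
    injective′ : ∀ i j i′ j′ → toℕ j < L′ (toℕ i) → toℕ j′ < L′ (toℕ i′) →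
                 label (del a) i j ≡ label (del a) i′ j′ → i ≡ i′ × j ≡ j′
    injective′ i j i′ j′ h h′
      rewrite old-label i j (present′⇒old i j h) | old-label i′ j′ (present′⇒old i′ j′ h′) =
      injective i j i′ j′ (present′⇒present i j h) (present′⇒present i′ j′ h′)
    surjective′ : ∀ m → 1 ≤ m → m ≤ s →
                  Σ (Fin n) λ i → Σ (Fin k) λ j → toℕ j < L′ (toℕ i) × label (del a) i j ≡ m
    surjective′ m pos bound with surjective m pos (m≤n⇒m≤1+n bound)
    ... | i , j , h , e = i , j , present⇒present′ i j h old , trans (old-label i j old) e
      where
      old : ¬ New i j
      old (refl , refl) = <-irrefl (trans (sym e) is-max) (s≤s bound)
    positive : ∀ i j → toℕ j < L′ (toℕ i) → 0 < label (del a) i j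
    positive i j h = proj₁ (inRange′ i j h)
    rowIncr′ : ∀ i (j j′ : Fin k) → toℕ j < toℕ j′ → toℕ j′ < L′ (toℕ i) →
               label (del a) i j < label (del a) i j′
    rowIncr′ i j j′ lt h′ with new? i j
    ... | yes (refl , refl) rewrite new-label = positive i j′ h′
    ... | no old rewrite old-label i j old | old-label i j′ (present′⇒old i j′ h′) =
      rowIncr i j j′ lt (present′⇒present i j′ h′)
    colIncr′ : ∀ (i i′ : Fin n) (j j′ : Fin k) → toℕ i < toℕ i′ → toℕ i + toℕ j ≡ toℕ i′ + toℕ j′ →
               toℕ j′ < L′ (toℕ i′) → label (del a) i j < label (del a) i′ j′
    colIncr′ i i′ j j′ lt same-col h′ with new? i j
    ... | yes (refl , refl) rewrite new-label = positive i′ j′ h′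
    ... | no old rewrite old-label i j old | old-label i′ j′ (present′⇒old i′ j′ h′) =
      colIncr i i′ j j′ lt same-col (present′⇒present i′ j′ h′)

  add-del : ∀ a → label a r₀ j₀ ≡ suc s → add (del a) ≡ a
  add-del a is-max = labeling-ext same
    where
    same : ∀ i j → label (add (del a)) i j ≡ label a i j
    same i j with new? i j
    ... | yes (refl , refl) = trans (relabel-same (del a) r₀ j₀ (suc s)) (sym is-max)
    ... | no old = trans (relabel-other (del a) r₀ j₀ (suc s) i j old) (relabel-other a r₀ j₀ 0 i j old)

  add-injective : ∀ b b′ → IsGT n k L′ s b → IsGT n k L′ s b′ → add b ≡ add b′ → b ≡ b′
  add-injective b b′ B B′ e = labeling-ext same
    where
    zero-at-new : ∀ {d} → IsGT n k L′ s d → label d r₀ j₀ ≡ 0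
    zero-at-new D = IsGT.absent D r₀ j₀ (subst₂ _≤_ (sym L′-row) (sym j₀≡) ≤-refl)
    same : ∀ i j → label b i j ≡ label b′ i j
    same i j with new? i j
    ... | yes (refl , refl) = trans (zero-at-new B) (sym (zero-at-new B′))
    ... | no old = trans (sym (relabel-other b r₀ j₀ (suc s) i j old))
                     (trans (cong (λ T → label T i j) e) (relabel-other b′ r₀ j₀ (suc s) i j old))

  count : ∀ {m} → HasCard (IsGT n k L′ s) m → HasCard (MaxAt s c) m
  count = card-image add add-injective (λ b B → add-GT b B , r₀ , j₀ , r₀≡ , j₀≡ , relabel-same b r₀ j₀ (suc s)) onto
    where
    onto : ∀ a → MaxAt s c a → Σ (Labeling n k) λ b → IsGT n k L′ s b × add b ≡ a
    onto a (G , r , j , r≡ , j≡ , is-max)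
      with toℕ-injective {i = r} {j = r₀} (trans r≡ (sym r₀≡)) | toℕ-injective {i = j} {j = j₀} (trans j≡ (sym j₀≡))
    ... | refl | refl = del a , del-GT a G is-max , add-del a is-max

MaxAt-row : ∀ {n k L s} {a : Labeling n k} (c c′ : Corner L) → row c ≡ row c′ → MaxAt s c a → MaxAt s c′ a
MaxAt-row c c′ same (G , i , j , i≡ , j≡ , is-max) =
  G , i , j , trans i≡ same , trans j≡ (corner-col c c′ same) , is-max

count-one-corner : ∀ {n k L s m} → Admissible n k L → (c : Corner L) → (∀ c′ → row c′ ≡ row c) →
  HasCard (IsGT n k (removeCorner c) s) m → HasCard (IsGT n k L (suc s)) m
count-one-corner {n} {k} {L} {s} A c only = card-cong (λ _ → proj₁) max-at-c ∘ Removal.count A c s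
  where
  max-at-c : ∀ a → IsGT n k L (suc s) a → MaxAt s c a
  max-at-c a G = let (c′ , max) = max-at-corner A G in MaxAt-row c′ c (only c′) max

count-two-corners : ∀ {n k L s m₁ m₂} → Admissible n k L → (c d : Corner L) → row c ≢ row d →
  (∀ c′ → row c′ ≡ row c ⊎ row c′ ≡ row d) →
  HasCard (IsGT n k (removeCorner c) s) m₁ → HasCard (IsGT n k (removeCorner d) s) m₂ →
  HasCard (IsGT n k L (suc s)) (m₁ + m₂)
count-two-corners {n} {k} {L} {s} A c d c≢d only counts₁ counts₂ =
  card-union disjoint cover (λ _ → proj₁) (λ _ → proj₁) (Removal.count A c s counts₁) (Removal.count A d s counts₂)
  where
  disjoint : ∀ a → MaxAt s c a → MaxAt s d a → ⊥
  disjoint a (G , i , j , i≡ , j≡ , max₁) (_ , i′ , j′ , i′≡ , j′≡ , max₂) =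
    c≢d (trans (sym i≡) (trans (cong toℕ (proj₁ (IsGT.injective G i j i′ j′ (present c i≡ j≡) (present d i′≡ j′≡)
                                                     (trans max₁ (sym max₂))))) i′≡))
    where
    present : ∀ (e : Corner L) {i : Fin n} {j : Fin k} → toℕ i ≡ row e → toℕ j ≡ col e → toℕ j < L (toℕ i)
    present e refl refl = subst (col e <_) (sym (lastBox e)) ≤-refl
  cover : ∀ a → IsGT n k L (suc s) a → MaxAt s c a ⊎ MaxAt s d a
  cover a G with max-at-corner A G
  ... | c′ , max with only c′
  ...   | inj₁ at-c = inj₁ (MaxAt-row c′ c at-c max)
  ...   | inj₂ at-d = inj₂ (MaxAt-row c′ d at-d max)

rows : List ℕ → Profile
rows []      _       = 0
rows (a ∷ p) zero    = a
rows (a ∷ p) (suc x) = rows p x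

fullThen : ℕ → List ℕ → Profile
fullThen zero    p x       = rows p x
fullThen (suc f) p zero    = 4
fullThen (suc f) p (suc x) = fullThen f p x

fullThen-full : ∀ f p x → x < f → fullThen f p x ≡ 4
fullThen-full (suc f) p zero    _       = refl
fullThen-full (suc f) p (suc x) (s≤s x<f) = fullThen-full f p x x<f

fullThen-tail : ∀ f p x → fullThen f p (f + x) ≡ rows p x
fullThen-tail zero    p x = refl
fullThen-tail (suc f) p x = fullThen-tail f p x

fullThen-first-tail : ∀ f p → fullThen f p f ≡ rows p 0
fullThen-first-tail zero    p = refl
fullThen-first-tail (suc f) p = fullThen-first-tail f p

fullThen-removable : ∀ f p x → Removable (rows p) x → Removable (fullThen f p) (f + x)
fullThen-removable zero    p x r = r
fullThen-removable (suc f) p x r = fullThen-removable f p x r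

ValidTail : List ℕ → Set
ValidTail p = All (_≤ 4) p × Linked _>_ p

validTail? : ∀ p → Dec (ValidTail p)
validTail? p = all? (_≤? 4) p ×-dec linked? _>?_ p

fullThen-admissible : ∀ {n} f p → ValidTail p → f + length p ≤ n → Admissible n 4 (fullThen f p)
fullThen-admissible {n} f p (bounded , decreasing) fits = record
  { bounded  = bounded′ f
  ; vanishes = λ x n≤x → vanishes′ f x (≤-trans fits n≤x)
  ; shortens = shortens′ f }
  where
  rows-bounded : ∀ {q} → All (_≤ 4) q → ∀ x → rows q x ≤ 4
  rows-bounded []      x       = z≤n
  rows-bounded (a≤ ∷ _) zero   = a≤
  rows-bounded (_ ∷ q≤) (suc x) = rows-bounded q≤ x
  rows-shortens : ∀ {q} → Linked _>_ q → ∀ x → rows q (suc x) ≡ 0 ⊎ rows q (suc x) < rows q x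
  rows-shortens []        x       = inj₁ refl
  rows-shortens [-]       x       = inj₁ refl
  rows-shortens (a>b ∷ _) zero    = inj₂ a>b
  rows-shortens (_ ∷ q>)  (suc x) = rows-shortens q> x
  rows-vanishes : ∀ q x → length q ≤ x → rows q x ≡ 0
  rows-vanishes []      x       _         = refl
  rows-vanishes (a ∷ q) (suc x) (s≤s l≤x) = rows-vanishes q x l≤x
  bounded′ : ∀ f x → fullThen f p x ≤ 4
  bounded′ zero    x       = rows-bounded bounded x
  bounded′ (suc f) zero    = ≤-refl
  bounded′ (suc f) (suc x) = bounded′ f x
  vanishes′ : ∀ f x → f + length p ≤ x → fullThen f p x ≡ 0
  vanishes′ zero    x       l≤x       = rows-vanishes p x l≤x
  vanishes′ (suc f) (suc x) (s≤s l≤x) = vanishes′ f x l≤x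
  shortens′ : ∀ f x → fullThen f p (suc x) ≡ 0 ⊎ fullThen f p x ≡ 4 ⊎ fullThen f p (suc x) < fullThen f p x
  shortens′ zero    x with rows-shortens decreasing x
  ... | inj₁ empty = inj₁ empty
  ... | inj₂ short = inj₂ (inj₂ short)
  shortens′ (suc f) zero    = inj₂ (inj₁ refl)
  shortens′ (suc f) (suc x) = shortens′ f x

removable? : ∀ L x → Dec (Removable L x)
removable? L x = (L x ≟ 1) ⊎-dec (L (suc x) + 2 ≤? L x)

tailCorners : List ℕ → List ℕ
tailCorners p = filter (removable? (rows p)) (upTo (length p))

tailCorner-listed : ∀ p x → Removable (rows p) x → x ∈ tailCorners p
tailCorner-listed p x r = ∈-filter⁺ (removable? (rows p)) (∈-upTo⁺ (inside p x r)) r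
  where
  nonempty : ∀ {L x} → Removable L x → 0 < L x
  nonempty {L} {x} (inj₁ single) = subst (0 <_) (sym single) ≤-refl
  nonempty {L} {x} (inj₂ long)   = ≤-trans (s≤s z≤n) (≤-trans (m≤n+m 2 (L (suc x))) long)
  inside : ∀ q x → Removable (rows q) x → x < length q
  inside [] x r = ⊥-elim (<-irrefl refl (nonempty {rows []} {x} r))
  inside (a ∷ q) zero    r = s≤s z≤n
  inside (a ∷ q) (suc x) r = s≤s (inside q x r)

tailCorner-removable : ∀ p x → x ∈ tailCorners p → Removable (rows p) x
tailCorner-removable p x mem = proj₂ (∈-filter⁻ (removable? (rows p)) {xs = upTo (length p)} mem)

fullThen-corner : ∀ f p (c : Corner (fullThen f p)) →
  (f ≡ suc (row c) × rows p 0 ≤ 2) ⊎ (Σ ℕ λ x → row c ≡ f + x × x ∈ tailCorners p)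
fullThen-corner zero p (corner R J last r) = inj₂ (R , refl , tailCorner-listed p R r)
fullThen-corner (suc zero) p (corner zero J last (inj₂ long)) =
  inj₁ (refl , ≤-pred (≤-pred (subst (_≤ 4) (+-comm (rows p 0) 2) long)))
fullThen-corner (suc (suc f)) p (corner zero J last (inj₂ (s≤s (s≤s (s≤s (s≤s ()))))))
fullThen-corner (suc f) p (corner (suc R) J last r) with fullThen-corner f p (corner R J last r)
... | inj₁ (f≡ , short)   = inj₁ (cong suc f≡ , short)
... | inj₂ (x , R≡ , mem) = inj₂ (x , cong suc R≡ , mem)

tailCorner : ∀ f p x → Removable (rows p) x → Corner (fullThen f p)
tailCorner f p x r = corner (f + x) (pred (rows p x)) (trans (fullThen-tail f p x) (last-box {rows p} {x} r))
                            (fullThen-removable f p x r)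
  where
  last-box : ∀ {L x} → Removable L x → L x ≡ suc (pred (L x))
  last-box {L} {x} r with L x | r
  ... | suc _ | _       = refl
  ... | zero  | inj₂ long with ≤-trans (m≤n+m 2 (L (suc x))) long
  ...   | ()

fullCorner : ∀ g p → rows p 0 ≤ 2 → Corner (fullThen (suc g) p)
fullCorner g p short = corner g 3 (fullThen-full (suc g) p g ≤-refl)
  (inj₂ (subst₂ (λ a b → a + 2 ≤ b) (sym (fullThen-first-tail g p)) (sym (fullThen-full (suc g) p g ≤-refl))
                (+-monoˡ-≤ 2 short)))

-- The tail p with row x shortened by one box; a row that becomes empty at
-- the end of the tail is dropped, so that tails never end in 0.
lower : List ℕ → ℕ → List ℕ
lower []                  _       = []
lower (a ∷ p)             (suc x) = a ∷ lower p x
lower (a ∷ b ∷ p)         zero    = pred a ∷ b ∷ p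
lower (zero ∷ [])         zero    = []
lower (suc zero ∷ [])     zero    = []
lower (suc (suc a) ∷ [])  zero    = suc a ∷ []

rows-lower-same : ∀ p x → rows (lower p x) x ≡ pred (rows p x)
rows-lower-same []                 x       = refl
rows-lower-same (zero ∷ [])        zero    = refl
rows-lower-same (suc zero ∷ [])    zero    = refl
rows-lower-same (suc (suc a) ∷ []) zero    = refl
rows-lower-same (a ∷ b ∷ p)        zero    = refl
rows-lower-same (a ∷ p)            (suc x) = rows-lower-same p x

rows-lower-other : ∀ p x y → y ≢ x → rows (lower p x) y ≡ rows p y
rows-lower-other []                 x       y       _   = refl
rows-lower-other (a ∷ [])           zero    zero    y≢x = ⊥-elim (y≢x refl)
rows-lower-other (zero ∷ [])        zero    (suc y) _   = refl
rows-lower-other (suc zero ∷ [])    zero    (suc y) _   = refl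
rows-lower-other (suc (suc a) ∷ []) zero    (suc y) _   = refl
rows-lower-other (a ∷ b ∷ p)        zero    zero    y≢x = ⊥-elim (y≢x refl)
rows-lower-other (a ∷ b ∷ p)        zero    (suc y) _   = refl
rows-lower-other (a ∷ p)            (suc x) zero    _   = refl
rows-lower-other (a ∷ p)            (suc x) (suc y) y≢x = rows-lower-other p x y (y≢x ∘ cong suc)

length-lower : ∀ p x → length (lower p x) ≤ length p
length-lower []                 x       = z≤n
length-lower (zero ∷ [])        zero    = z≤n
length-lower (suc zero ∷ [])    zero    = z≤n
length-lower (suc (suc a) ∷ []) zero    = ≤-refl
length-lower (a ∷ b ∷ p)        zero    = ≤-refl
length-lower (a ∷ p)            (suc x) = s≤s (length-lower p x)

remove-tail : ∀ f p x (r : Removable (rows p) x) y →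
  fullThen f (lower p x) y ≡ removeCorner (tailCorner f p x r) y
remove-tail f p x r = shorten-unique (fullThen f p) (f + x) (pred (rows p x))
  (trans (fullThen-tail f (lower p x) x) (rows-lower-same p x)) (other f)
  where
  other : ∀ f y → y ≢ f + x → fullThen f (lower p x) y ≡ fullThen f p y
  other zero    y       y≢ = rows-lower-other p x y y≢
  other (suc f) zero    _  = refl
  other (suc f) (suc y) y≢ = other f y (y≢ ∘ cong suc)

remove-full : ∀ g p (short : rows p 0 ≤ 2) y →
  fullThen g (3 ∷ p) y ≡ removeCorner (fullCorner g p short) y
remove-full g p short = shorten-unique (fullThen (suc g) p) g 3 (fullThen-first-tail g (3 ∷ p)) (other g)
  where
  other : ∀ g y → y ≢ g → fullThen g (3 ∷ p) y ≡ fullThen (suc g) p y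
  other zero    zero    y≢ = ⊥-elim (y≢ refl)
  other zero    (suc y) _  = refl
  other (suc g) zero    _  = refl
  other (suc g) (suc y) y≢ = other g y (y≢ ∘ cong suc)

CountAt : ℕ → ℕ → List ℕ → ℕ → ℕ → Set
CountAt n f p s m = f + length p ≤ n → HasCard (IsGT n 4 (fullThen f p) s) m

-- The last full row is not a corner: there is none, or the tail starts with 3 boxes.
NoFullCorner : ℕ → List ℕ → Set
NoFullCorner f p = f ≡ 0 ⊎ 2 < rows p 0

-- Validity of the tail and the bound
-- on its first row are decided by evaluation for the concrete tails.
module _ {n : ℕ} where

  private
    listed-only : ∀ {x y : ℕ} → y ∈ x ∷ [] → y ≡ x
    listed-only (here y≡x) = y≡x

    no-full-corner : ∀ {f p} → NoFullCorner f p → ∀ c →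
      Σ ℕ λ x → row c ≡ f + x × x ∈ tailCorners p
    no-full-corner {f} {p} none c with fullThen-corner f p c | none
    ... | inj₁ (f≡ , _)       | inj₁ f≡0  = ⊥-elim (0≢1+n (trans (sym f≡0) f≡))
    ... | inj₁ (_ , short)    | inj₂ long = ⊥-elim (<⇒≱ long short)
    ... | inj₂ tail-corner    | _         = tail-corner

    fits-lower : ∀ f p x → f + length p ≤ n → f + length (lower p x) ≤ n
    fits-lower f p x fits = ≤-trans (+-monoʳ-≤ f (length-lower p x)) fits

    fits-cap : ∀ g p → suc g + length p ≤ n → g + length (3 ∷ p) ≤ n
    fits-cap g p fits = subst (_≤ n) (sym (+-suc g (length p))) fits

  count-tail : ∀ {s m} f p x {valid : True (validTail? p)} →
    tailCorners p ≡ x ∷ [] → NoFullCorner f p →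
    CountAt n f (lower p x) s m → CountAt n f p (suc s) m
  count-tail f p x {valid} listed none lowered fits =
    count-one-corner (fullThen-admissible f p (toWitness valid) fits) c only
      (card-IsGT-cong (remove-tail f p x r) (lowered (fits-lower f p x fits)))
    where
    r = tailCorner-removable p x (subst (x ∈_) (sym listed) (here refl))
    c = tailCorner f p x r
    only : ∀ c′ → row c′ ≡ row c
    only c′ with no-full-corner none c′
    ... | y , row≡ , mem = trans row≡ (cong (f +_) (listed-only (subst (y ∈_) listed mem)))

  count-tail-and-full : ∀ {s m₁ m₂} g p x {valid : True (validTail? p)} {short : True (rows p 0 ≤? 2)} →
    tailCorners p ≡ x ∷ [] →
    CountAt n (suc g) (lower p x) s m₁ → CountAt n g (3 ∷ p) s m₂ → CountAt n (suc g) p (suc s) (m₁ + m₂)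
  count-tail-and-full g p x {valid} {short} listed lowered capped fits =
    count-two-corners (fullThen-admissible (suc g) p (toWitness valid) fits) c d
      (λ e → <-irrefl (sym e) (s≤s (m≤m+n g x))) only
      (card-IsGT-cong (remove-tail (suc g) p x r) (lowered (fits-lower (suc g) p x fits)))
      (card-IsGT-cong (remove-full g p (toWitness short)) (capped (fits-cap g p fits)))
    where
    r = tailCorner-removable p x (subst (x ∈_) (sym listed) (here refl))
    c = tailCorner (suc g) p x r
    d = fullCorner g p (toWitness short)
    only : ∀ c′ → row c′ ≡ row c ⊎ row c′ ≡ row d
    only c′ with fullThen-corner (suc g) p c′
    ... | inj₁ (g≡ , _)        = inj₂ (suc-injective (sym g≡))
    ... | inj₂ (y , row≡ , mem) =
      inj₁ (trans row≡ (cong (suc g +_) (listed-only (subst (y ∈_) listed mem))))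

  count-full : ∀ {s m} g p {valid : True (validTail? p)} {short : True (rows p 0 ≤? 2)} →
    tailCorners p ≡ [] → CountAt n g (3 ∷ p) s m → CountAt n (suc g) p (suc s) m
  count-full g p {valid} {short} listed capped fits =
    count-one-corner (fullThen-admissible (suc g) p (toWitness valid) fits) d only
      (card-IsGT-cong (remove-full g p (toWitness short)) (capped (fits-cap g p fits)))
    where
    d = fullCorner g p (toWitness short)
    only : ∀ c′ → row c′ ≡ row d
    only c′ with fullThen-corner (suc g) p c′
    ... | inj₁ (g≡ , _)       = suc-injective (sym g≡)
    ... | inj₂ (y , _ , mem) with subst (y ∈_) listed mem
    ...   | ()

  count-two-tails : ∀ {s m₁ m₂} f p x y {valid : True (validTail? p)} →
    tailCorners p ≡ x ∷ y ∷ [] → x ≢ y → NoFullCorner f p →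
    CountAt n f (lower p x) s m₁ → CountAt n f (lower p y) s m₂ → CountAt n f p (suc s) (m₁ + m₂)
  count-two-tails f p x y {valid} listed x≢y none lowered₁ lowered₂ fits =
    count-two-corners (fullThen-admissible f p (toWitness valid) fits) c d
      (x≢y ∘ +-cancelˡ-≡ f x y) only
      (card-IsGT-cong (remove-tail f p x rx) (lowered₁ (fits-lower f p x fits)))
      (card-IsGT-cong (remove-tail f p y ry) (lowered₂ (fits-lower f p y fits)))
    where
    rx = tailCorner-removable p x (subst (x ∈_) (sym listed) (here refl))
    ry = tailCorner-removable p y (subst (y ∈_) (sym listed) (there (here refl)))
    c = tailCorner f p x rx
    d = tailCorner f p y ry
    only : ∀ c′ → row c′ ≡ row c ⊎ row c′ ≡ row d
    only c′ with no-full-corner none c′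
    ... | z , row≡ , mem with subst (z ∈_) listed mem
    ...   | here refl         = inj₁ row≡
    ...   | there (here refl) = inj₂ row≡

-- P_{k-1}, with the extension P_{-1} = 1 forced by the Pell recurrence.
pell₋₁ : ℕ → ℕ
pell₋₁ zero    = 1
pell₋₁ (suc k) = Pell k

-- double f = 2 f, by a recursion that makes  double (suc f)  reduce.
double : ℕ → ℕ
double zero    = 0
double (suc f) = suc (suc (double f))

-- The two ways the corner recurrence assembles P_{k+2} = 2 P_{k+1} + P_k.
a+b+b≡2b+a : ∀ a b → a + b + b ≡ 2 * b + a
a+b+b≡2b+a = solve-∀

b+a+b≡2b+a : ∀ a b → b + a + b ≡ 2 * b + a
b+a+b≡2b+a = solve-∀

Count : List ℕ → (ℕ → ℕ) → Set
Count p c = ∀ n f → CountAt n f p (sum p + f * 4) (c f)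

CountAt-≡ : ∀ {n f p s m m′} → m ≡ m′ → CountAt n f p s m → CountAt n f p s m′
CountAt-≡ m≡m′ count fits = subst (HasCard _) m≡m′ (count fits)

-- The eight tails reachable from the full shape by removing corners, and
-- their counts.
count-∅   : Count [] (λ f → pell₋₁ (double f))
count-1   : Count (1 ∷ []) (λ f → pell₋₁ (double f) + pell₋₁ (1 + double f))
count-2   : Count (2 ∷ []) (λ f → pell₋₁ (2 + double f))
count-3   : Count (3 ∷ []) (λ f → pell₋₁ (2 + double f))
count-21  : Count (2 ∷ 1 ∷ []) (λ f → pell₋₁ (2 + double f) + pell₋₁ (1 + double f))
count-31  : Count (3 ∷ 1 ∷ []) (λ f → pell₋₁ (3 + double f))
count-32  : Count (3 ∷ 2 ∷ []) (λ f → pell₋₁ (3 + double f))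
count-321 : Count (3 ∷ 2 ∷ 1 ∷ []) (λ f → pell₋₁ (3 + double f))

count-∅ n zero    = λ _ → card-empty (λ _ → refl)
count-∅ n (suc g) = count-full g [] refl (count-3 n g)

count-1 n zero    = count-tail 0 (1 ∷ []) 0 refl (inj₁ refl) (count-∅ n 0)
count-1 n (suc g) = count-tail-and-full g (1 ∷ []) 0 refl (count-∅ n (suc g)) (count-31 n g)

count-2 n zero    = count-tail 0 (2 ∷ []) 0 refl (inj₁ refl) (count-1 n 0)
count-2 n (suc g) = CountAt-≡ {f = suc g} {p = 2 ∷ []}
  (a+b+b≡2b+a (pell₋₁ (double (suc g))) (pell₋₁ (1 + double (suc g))))
  (count-tail-and-full g (2 ∷ []) 0 refl (count-1 n (suc g)) (count-32 n g))

count-3 n f = count-tail f (3 ∷ []) 0 refl (inj₂ ≤-refl) (count-2 n f)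

count-21 n zero    = count-tail 0 (2 ∷ 1 ∷ []) 1 refl (inj₁ refl) (count-2 n 0)
count-21 n (suc g) = count-tail-and-full g (2 ∷ 1 ∷ []) 1 refl (count-2 n (suc g)) (count-321 n g)

count-31 n f = CountAt-≡ {f = f} {p = 3 ∷ 1 ∷ []} (b+a+b≡2b+a (pell₋₁ (1 + double f)) (pell₋₁ (2 + double f)))
  (count-two-tails f (3 ∷ 1 ∷ []) 0 1 refl (λ ()) (inj₂ ≤-refl) (count-21 n f) (count-3 n f))

count-32 n f = count-tail f (3 ∷ 2 ∷ []) 1 refl (inj₂ ≤-refl) (count-31 n f)

count-321 n f = count-tail f (3 ∷ 2 ∷ 1 ∷ []) 2 refl (inj₂ ≤-refl) (count-32 n f)

double-≡ : ∀ m → double m ≡ 2 * m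
double-≡ zero    = refl
double-≡ (suc m) = cong suc (trans (cong suc (double-≡ m)) (sym (+-suc m (m + 0))))

odd-index : ∀ m → 2 * suc m ∸ 1 ≡ suc (double m)
odd-index m = trans (+-suc m (m + 0)) (cong suc (sym (double-≡ m)))

syt-count : (n : ℕ) → 1 ≤ n → NumSYT n 4 (Pell (2 * n ∸ 1))
syt-count (suc m) _ =
  subst (NumSYT (suc m) 4) (cong Pell (sym (odd-index m)))
    (card-cong (λ _ → GT⇒SYT full) (λ _ → SYT⇒GT full)
               (count-∅ (suc m) (suc m) (≤-reflexive (+-identityʳ (suc m)))))
  where
  full : ∀ (i : Fin (suc m)) → fullThen (suc m) [] (toℕ i) ≡ 4
  full i = fullThen-full (suc m) [] (toℕ i) (toℕ<n i)

pell-skip : ∀ k → Pell (4 + k) + Pell k ≡ 6 * Pell (2 + k)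
pell-skip k = unfolded (Pell k) (Pell (suc k))
  where
  unfolded : ∀ x y → 2 * (2 * (2 * y + x) + y) + (2 * y + x) + x ≡ 6 * (2 * y + x)
  unfolded = solve-∀

syt-recurrence : (n a b c : ℕ) → 3 ≤ n → NumSYT n 4 a → NumSYT (n ∸ 1) 4 b →
                 NumSYT (n ∸ 2) 4 c → a ≡ 6 * b ∸ c
syt-recurrence (suc (suc zero)) _ _ _ (s≤s (s≤s ()))
syt-recurrence (suc (suc (suc m))) a b c _ A B C = begin
  a                                     ≡⟨ g≡ (suc (suc m)) A ⟩
  Pell (4 + k)                          ≡⟨ sym (m+n∸n≡m (Pell (4 + k)) (Pell k)) ⟩
  Pell (4 + k) + Pell k ∸ Pell k        ≡⟨ cong (_∸ Pell k) (pell-skip k) ⟩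
  6 * Pell (2 + k) ∸ Pell k             ≡⟨ cong₂ (λ x y → 6 * x ∸ y) (sym (g≡ (suc m) B)) (sym (g≡ m C)) ⟩
  6 * b ∸ c                             ∎
  where
  open ≡-Reasoning
  k = suc (double m)
  g≡ : ∀ {x} j → NumSYT (suc j) 4 x → x ≡ Pell (suc (double j))
  g≡ j G = trans (card-unique G (syt-count (suc j) (s≤s z≤n))) (cong Pell (odd-index j))

theorem2 : ((n : ℕ) → 1 ≤ n → NumSYT n 4 (Pell (2 * n ∸ 1)))
           × ((n a b c : ℕ) → 3 ≤ n → NumSYT n 4 a → NumSYT (n ∸ 1) 4 b →
                NumSYT (n ∸ 2) 4 c → a ≡ 6 * b ∸ c)
           × NumSYT 1 4 1
           × NumSYT 2 4 5
theorem2 = syt-count , syt-recurrence , syt-count 1 (s≤s z≤n) , syt-count 2 (s≤s z≤n)
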